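{- Let $w\in S_n$ and suppose the first descent of $w$, at position $i$, is a heavy reduction pair. Then for every prime power $q$, $$\mathrm{M}_w(q)=\mathrm{M}_{s_iw}(q)+q^n\cdot\frac{\#\mathcal{M}(n-1,\,O_w-(i+1,w_i))}{(q-1)^{n-1}}.$$
   Context: $O_w=\{(a,w_b):a<b,\ w_b>w_a\}\subseteq[n]\times[n]$. For $D\subseteq[m]\times[m]$, $\mathcal{M}(m,D)$ is the set of invertible $m\times m$ matrices over $\mathbf{F}_q$ whose entry at position $(a,b)$ (row $a$, column $b$) is zero for all $(a,b)\in D$; $\mathrm{M}_w(q)=\#\mathcal{M}(n,O_w)/(q-1)^n$. For $D\subseteq[n]\times[n]$ and $(a,b)\in[n]\times[n]$, $D-(a,b)\subseteq[n-1]\times[n-1]$ is obtained from $D$ by deleting row $a$ and column $b$ and reindexing the remaining rows and columns order-preservingly. $s_iw$ swaps the entries of $w$ in positions $i,i+1$. The descent at $i$ ($w_i>w_{i+1}$) is a heavy reduction pair if: (1) no $k>i+1$ has $w_k<w_{i+1}$; (2) no $k<i$ has $w_k>w_i$; (3) there is an integer $m$ with $w_{i+1}\le m\le w_i$ such that no $k<i$ has $w_{i+1}<w_k\le m$ and no $k>i+1$ has $m<w_k<w_i$. -}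

module Defs where

open import Level using (0ℓ)
open import Data.Nat as ℕ using (ℕ; zero; suc)
open import Data.Fin as Fin using (Fin; zero; suc; inject₁; punchIn)
open import Data.Vec using (Vec; lookup; tabulate)
open import Data.List using (List; length)
open import Data.List.Relation.Unary.Unique.Propositional using (Unique)
open import Data.List.Membership.Propositional using (_∈_)
open import Data.Product using (Σ; ∃; _×_; _,_)
open import Relation.Nullary using (¬_)
open import Relation.Binary.PropositionalEquality using (_≡_)
open import Function.Bundles using (_↔_; _⇔_)
open import Algebra.Structures using (IsCommutativeRing)

record FiniteField (q : ℕ) : Set₁ where
  field
    Carrier : Set
    _+_ _*_ : Carrier → Carrier → Carrier
    -_      : Carrier → Carrier
    0# 1#   : Carrier
    isCommutativeRing : IsCommutativeRing _≡_ _+_ _*_ -_ 0# 1#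
    0≢1     : ¬ (0# ≡ 1#)
    inverse : ∀ x → ¬ (x ≡ 0#) → Σ Carrier λ y → (x * y) ≡ 1#
    card    : Carrier ↔ Fin q

module _ {q : ℕ} (F : FiniteField q) where
  open FiniteField F

  Mat : ℕ → Set
  Mat m = Vec (Vec Carrier m) m

  entry : ∀ {m} → Mat m → Fin m → Fin m → Carrier
  entry A r c = lookup (lookup A r) c

  sumF : ∀ {m} → (Fin m → Carrier) → Carrier
  sumF {zero}  f = 0#
  sumF {suc m} f = f zero + sumF (λ k → f (suc k))

  _·_ : ∀ {m} → Mat m → Mat m → Mat m
  A · B = tabulate λ r → tabulate λ c → sumF λ k → entry A r k * entry B k c

  identity : ∀ {m} → Mat m
  identity = tabulate λ r → tabulate λ c → δ r c
    where
    δ : ∀ {m} → Fin m → Fin m → Carrier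
    δ zero    zero    = 1#
    δ zero    (suc _) = 0#
    δ (suc _) zero    = 0#
    δ (suc r) (suc c) = δ r c

  Invertible : ∀ {m} → Mat m → Set
  Invertible A = Σ (Mat _) λ B → (A · B ≡ identity) × (B · A ≡ identity)

  InM : (m : ℕ) → (Fin m → Fin m → Set) → Mat m → Set
  InM m D A = Invertible A × (∀ r c → D r c → entry A r c ≡ 0#)

HasCard : {A : Set} → (A → Set) → ℕ → Set
HasCard {A} P k =
  Σ (List A) λ xs → Unique xs × (∀ x → (x ∈ xs) ⇔ P x) × (length xs ≡ k)

-- Permutations (as injective maps Fin n → Fin n) and the diagram O_w

O : ∀ {n} → (Fin n → Fin n) → Fin n → Fin n → Set
O {n} w r c = ∃ λ (b : Fin n) → (r Fin.< b) × (w b ≡ c) × (w r Fin.< c)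

-- D − (a, b): delete row a and column b, reindex order-preservingly
_minus_ : ∀ {m} → (Fin (suc m) → Fin (suc m) → Set) → Fin (suc m) × Fin (suc m)
        → Fin m → Fin m → Set
(D minus (a , b)) r c = D (punchIn a r) (punchIn b c)

-- transposition of positions i and i+1 (0-indexed: inject₁ i and suc i)
swapAdj : ∀ {m} → Fin m → Fin (suc m) → Fin (suc m)
swapAdj zero    zero          = suc zero
swapAdj zero    (suc zero)    = zero
swapAdj zero    (suc (suc k)) = suc (suc k)
swapAdj (suc i) zero          = zero
swapAdj (suc i) (suc k)       = suc (swapAdj i k)

sAct : ∀ {m} → Fin m → (Fin (suc m) → Fin (suc m)) → Fin (suc m) → Fin (suc m)
sAct i w k = w (swapAdj i k)

FirstDescentAt : ∀ {m} → (Fin (suc m) → Fin (suc m)) → Fin m → Set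
FirstDescentAt w i =
  (w (suc i) Fin.< w (inject₁ i)) ×
  (∀ k → k Fin.< i → w (inject₁ k) Fin.< w (suc k))

HeavyReductionPair : ∀ {m} → (Fin (suc m) → Fin (suc m)) → Fin m → Set
HeavyReductionPair {m} w i =
  (w (suc i) Fin.< w (inject₁ i)) ×
  (∀ k → suc i Fin.< k → ¬ (w k Fin.< w (suc i))) ×
  (∀ k → k Fin.< inject₁ i → ¬ (w (inject₁ i) Fin.< w k)) ×
  (∃ λ (μ : Fin (suc m)) →
     (w (suc i) Fin.≤ μ) × (μ Fin.≤ w (inject₁ i)) ×
     (∀ k → k Fin.< inject₁ i → ¬ ((w (suc i) Fin.< w k) × (w k Fin.≤ μ))) ×
     (∀ k → suc i Fin.< k → ¬ ((μ Fin.< w k) × (w k Fin.< w (inject₁ i)))))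

-- Split 𝓜(n, O_w) according to whether the pivot entry, at (i+1, w_i), vanishes.
--
-- Since w_i > w_{i+1}, the diagram O_{s_i w} is O_w with rows i and i+1 exchanged plus the
-- single position that the pivot moves to; so exchanging rows i and i+1 maps 𝓜(n, O_{s_i w})
-- bijectively onto the matrices of 𝓜(n, O_w) with zero pivot.
--
-- A matrix A with pivot p ≠ 0 is determined by p, its pivot row u, its pivot column v and its
-- Schur complement S = minor − v u / p, and A is invertible iff S is.  Conditions (1) and (2)
-- make every position (R, C) of O_w off the pivot lines have (R, w_i) or (i+1, C) in O_w, so
-- that v_R u_C = 0 there: A vanishes on O_w exactly when S vanishes on O_w − (i+1, w_i) and u, v
-- vanish on the pivot lines of O_w.  These leave i+1 free entries of u and n−1−i of v, so there are
-- q^n (q − 1) #𝓜(n−1, O_w − (i+1, w_i)) matrices with nonzero pivot.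

module Submission where

open import Defs
open import Level using (0ℓ)
open import Data.Nat as ℕ using (ℕ; zero; suc; _≤_; _^_)
import Data.Nat.Properties as ℕₚ
open import Data.Fin as Fin using (Fin; zero; suc; inject₁; punchIn; punchOut; toℕ)
import Data.Fin.Properties as Finₚ
open import Data.Fin.Permutation using (Permutation′; _⟨$⟩ʳ_; permutation)
open import Data.Vec using (Vec; []; _∷_; lookup; tabulate)
open import Data.Vec.Properties using (lookup∘tabulate; tabulate∘lookup; tabulate-cong)
open import Data.Vec.Functional using (insertAt)
open import Data.Vec.Functional.Properties using (insertAt-lookup; insertAt-punchIn)
open import Data.List using ([]; _∷_; length; map; _++_; filter; cartesianProduct; allFin)
open import Data.List.Properties using (length-map; length-++; length-tabulate)
open import Data.List.Relation.Unary.Unique.Propositional using (Unique)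
import Data.List.Relation.Unary.Unique.Propositional.Properties as Unique
open import Data.List.Relation.Unary.All as All using (All; []; _∷_)
import Data.List.Relation.Unary.All.Properties as AllProp
open import Data.List.Relation.Unary.AllPairs using ([]; _∷_)
open import Data.List.Relation.Unary.Any using (here; there)
open import Data.List.Membership.Propositional using (_∈_)
open import Data.List.Membership.Propositional.Properties
  using (∈-filter⁺; ∈-filter⁻; ∈-allFin; ∈-map⁺; ∈-map⁻; ∈-++⁺ˡ; ∈-++⁺ʳ; ∈-++⁻; ∈-cartesianProduct⁺; ∈-cartesianProduct⁻)
open import Data.List.Membership.Propositional.Properties.WithK using (unique∧set⇒bag)
open import Data.List.Relation.Binary.BagAndSetEquality using (∼bag⇒↭)
open import Data.List.Relation.Binary.Permutation.Propositional.Properties using (↭-length)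
open import Data.Maybe as Maybe using (nothing)
open import Data.Product using (Σ; ∃; _×_; _,_; proj₁; proj₂; uncurry)
open import Data.Sum as Sum using (_⊎_; inj₁; inj₂; [_,_])
open import Data.Empty using (⊥; ⊥-elim)
open import Data.Unit using (tt)
open import Function.Base using (_∘_; id)
open import Function.Bundles using (_⇔_; mk⇔; Equivalence; Inverse; Injection)
open import Function.Definitions using (Injective)
import Function.Properties.Equivalence as ⇔
open import Function.Properties.Inverse using (↔⇒↣; ↔-sym)
open import Relation.Nullary using (¬_; Dec; yes; no; ¬?)
open import Relation.Nullary.Decidable using (dec⇒maybe; _×-dec_)
open import Relation.Unary using (Pred; Decidable; _≐_; _∩_; ∁; _⟨×⟩_; U; ｛_｝)
open import Relation.Binary.Definitions using (DecidableEquality)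
open import Relation.Binary.PropositionalEquality hiding ([_])
open ≡-Reasoning
open import Algebra.Bundles using (CommutativeRing)
open import Algebra.Structures using (IsCommutativeRing)
import Algebra.Solver.Ring.AlmostCommutativeRing as ACR
open ACR using (_-Raw-AlmostCommutative⟶_)
import Tactic.RingSolver.Core.AlmostCommutativeRing as TACR

open Equivalence using (to; from)

-- Cardinalities of predicates

module _ {A : Set} where

  HasCard-unique : {P : Pred A 0ℓ} {k l : ℕ} → HasCard P k → HasCard P l → k ≡ l
  HasCard-unique (xs , xs! , xs⇔P , refl) (ys , ys! , ys⇔P , refl) =
    ↭-length (∼bag⇒↭ (unique∧set⇒bag xs! ys! (λ {x} → ⇔.trans (xs⇔P x) (⇔.sym (ys⇔P x)))))

  HasCard-resp-≐ : {P Q : Pred A 0ℓ} {k : ℕ} → P ≐ Q → HasCard P k → HasCard Q k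
  HasCard-resp-≐ (P⊆Q , Q⊆P) (xs , xs! , xs⇔P , |xs|) =
    xs , xs! , (λ x → mk⇔ (P⊆Q ∘ to (xs⇔P x)) (from (xs⇔P x) ∘ Q⊆P)) , |xs|

  HasCard-singleton : (a : A) → HasCard ｛ a ｝ 1
  HasCard-singleton a = a ∷ [] , [] ∷ [] , (λ x → mk⇔ (λ { (here refl) → refl }) (λ { refl → here refl })) , refl

  HasCard-empty : {P : Pred A 0ℓ} → (∀ x → ¬ P x) → HasCard P 0
  HasCard-empty ¬P = [] , [] , (λ x → mk⇔ (λ ()) (⊥-elim ∘ ¬P x)) , refl

  HasCard-split : {P D : Pred A 0ℓ} {k l : ℕ} → Decidable D →
                  HasCard (P ∩ D) k → HasCard (P ∩ ∁ D) l → HasCard P (k ℕ.+ l)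
  HasCard-split {P} {D} D? (xs , xs! , xs⇔ , refl) (ys , ys! , ys⇔ , refl) =
    xs ++ ys , Unique.++⁺ xs! ys! disjoint , (λ x → mk⇔ (member x ∘ ∈-++⁻ xs) (complete x)) , length-++ xs
    where
    disjoint : ∀ {x} → x ∈ xs × x ∈ ys → ⊥
    disjoint (x∈xs , x∈ys) = proj₂ (to (ys⇔ _) x∈ys) (proj₂ (to (xs⇔ _) x∈xs))
    member : ∀ x → x ∈ xs ⊎ x ∈ ys → P x
    member x = [ proj₁ ∘ to (xs⇔ x) , proj₁ ∘ to (ys⇔ x) ]
    complete : ∀ x → P x → x ∈ xs ++ ys
    complete x Px with D? x
    ... | yes Dx = ∈-++⁺ˡ (from (xs⇔ x) (Px , Dx))
    ... | no ¬Dx = ∈-++⁺ʳ xs (from (ys⇔ x) (Px , ¬Dx))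

  HasCard-image : {B : Set} {P : Pred A 0ℓ} {k : ℕ} (f : A → B) →
                  (∀ {a a′} → P a → P a′ → f a ≡ f a′ → a ≡ a′) →
                  HasCard P k → HasCard (λ b → ∃ λ a → P a × f a ≡ b) k
  HasCard-image {P = P} f f-injective (xs , xs! , xs⇔P , |xs|) =
    map f xs , map-unique xs! (All.tabulate (to (xs⇔P _))) ,
    (λ b → mk⇔ (λ b∈ → let a , a∈ , b≡fa = ∈-map⁻ f b∈ in a , to (xs⇔P a) a∈ , sym b≡fa)
               (λ { (a , Pa , refl) → ∈-map⁺ f (from (xs⇔P a) Pa) })) ,
    trans (length-map f xs) |xs|
    where
    map-unique : ∀ {ys} → Unique ys → All P ys → Unique (map f ys)
    map-unique []           []         = []
    map-unique (y∉ys ∷ ys!) (Py ∷ Pys) =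
      AllProp.map⁺ (All.zipWith (λ { (y≢z , Pz) fy≡fz → y≢z (f-injective Py Pz fy≡fz) }) (y∉ys , Pys))
      ∷ map-unique ys! Pys

  HasCard-filter : {P D : Pred A 0ℓ} {n : ℕ} → Decidable D → HasCard P n → ∃ λ l → HasCard (P ∩ D) l
  HasCard-filter D? (xs , xs! , xs⇔P , _) =
    _ , filter D? xs , Unique.filter⁺ D? xs! ,
    (λ x → mk⇔ (λ x∈ → let x∈xs , Dx = ∈-filter⁻ D? x∈ in to (xs⇔P x) x∈xs , Dx)
               (λ { (Px , Dx) → ∈-filter⁺ D? (from (xs⇔P x) Px) Dx })) ,
    refl

  HasCard-decidable : {P : Pred A 0ℓ} {n : ℕ} → Decidable P → HasCard U n → ∃ λ l → HasCard P l
  HasCard-decidable P? all = let l , U∩P = HasCard-filter P? all in l , HasCard-resp-≐ (proj₂ , (tt ,_)) U∩P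

  HasCard-∁ : {P : Pred A 0ℓ} {k n : ℕ} → Decidable P → HasCard U n → HasCard P k → HasCard (∁ P) (n ℕ.∸ k)
  HasCard-∁ {P} {k} {n} P? all Pk = subst (HasCard (∁ P)) l≡n∸k ∁Pl
    where
    l : ℕ
    l = proj₁ (HasCard-decidable (¬? ∘ P?) all)
    ∁Pl : HasCard (∁ P) l
    ∁Pl = proj₂ (HasCard-decidable (¬? ∘ P?) all)
    n≡k+l : n ≡ k ℕ.+ l
    n≡k+l = HasCard-unique all (HasCard-split P? (HasCard-resp-≐ ((tt ,_) , proj₂) Pk) (HasCard-resp-≐ ((tt ,_) , proj₂) ∁Pl))
    l≡n∸k : l ≡ n ℕ.∸ k
    l≡n∸k = trans (sym (ℕₚ.m+n∸m≡n k l)) (cong (ℕ._∸ k) (sym n≡k+l))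

module _ {A B : Set} where

  HasCard-× : {P : Pred A 0ℓ} {Q : Pred B 0ℓ} {k l : ℕ} → HasCard P k → HasCard Q l → HasCard (P ⟨×⟩ Q) (k ℕ.* l)
  HasCard-× (xs , xs! , xs⇔P , refl) (ys , ys! , ys⇔Q , refl) =
    cartesianProduct xs ys , Unique.cartesianProduct⁺ xs! ys! ,
    (λ { (a , b) → mk⇔ (λ ab∈ → let a∈ , b∈ = ∈-cartesianProduct⁻ xs ys ab∈ in to (xs⇔P a) a∈ , to (ys⇔Q b) b∈)
                        (λ { (Pa , Qb) → ∈-cartesianProduct⁺ (from (xs⇔P a) Pa) (from (ys⇔Q b) Qb) }) }) ,
    length-cartesianProduct xs
    where
    length-cartesianProduct : ∀ xs → length (cartesianProduct xs ys) ≡ length xs ℕ.* length ys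
    length-cartesianProduct []       = refl
    length-cartesianProduct (x ∷ xs) =
      trans (length-++ (map (x ,_) ys)) (cong₂ ℕ._+_ (length-map (x ,_) ys) (length-cartesianProduct xs))

HasCard-Fin : (k : ℕ) → HasCard (U {A = Fin k}) k
HasCard-Fin k = allFin k , Unique.allFin⁺ k , (λ j → mk⇔ _ (λ _ → ∈-allFin j)) , length-tabulate id

module _ {k l : ℕ} {P : Pred (Fin (suc k)) 0ℓ} (P∘suc : HasCard (P ∘ suc) l) where

  private
    P-nonzero : HasCard (P ∩ ∁ ｛ zero ｝) l
    P-nonzero = HasCard-resp-≐ ((λ { (j , Pj , refl) → Pj , λ () }) , suc-preimage)
                               (HasCard-image suc (λ _ _ → Finₚ.suc-injective) P∘suc)
      where
      suc-preimage : ∀ {j} → P j × zero ≢ j → ∃ λ a → P (suc a) × suc a ≡ j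
      suc-preimage {zero}  (_ , 0≢0) = ⊥-elim (0≢0 refl)
      suc-preimage {suc a} (Pj , _)  = a , Pj , refl

  HasCard-cons : P zero → HasCard P (suc l)
  HasCard-cons P0 =
    HasCard-split (zero Finₚ.≟_) (HasCard-resp-≐ ((λ { refl → P0 , refl }) , proj₂) (HasCard-singleton zero)) P-nonzero

  HasCard-skip : ¬ P zero → HasCard P l
  HasCard-skip ¬P0 = HasCard-split (zero Finₚ.≟_) (HasCard-empty λ { _ (P0 , refl) → ¬P0 P0 }) P-nonzero

HasCard-≤ : (k t : ℕ) → HasCard (λ (j : Fin k) → t ≤ toℕ j) (k ℕ.∸ t)
HasCard-≤ zero    t       = subst (HasCard _) (sym (ℕₚ.0∸n≡0 t)) (HasCard-empty λ ())
HasCard-≤ (suc k) zero    = HasCard-resp-≐ ((λ _ → ℕ.z≤n) , _) (HasCard-Fin (suc k))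
HasCard-≤ (suc k) (suc t) = HasCard-skip (HasCard-resp-≐ (ℕ.s≤s , ℕ.s≤s⁻¹) (HasCard-≤ k t)) λ ()

-- A ring solver with integer coefficients

-- Coefficients are taken in ℤ because, unlike elements of an abstract field, they can be compared
-- by computation, which the solver needs to cancel terms such as x + - x.
module ℤ-Solver {A : Set} {add mul : A → A → A} {neg : A → A} {0ᴬ 1ᴬ : A}
                (isCommutativeRing : IsCommutativeRing _≡_ add mul neg 0ᴬ 1ᴬ) where

  open import Data.Integer as ℤ using (ℤ; +_; -[1+_]; _⊖_)
  import Data.Integer.Properties as ℤₚ

  commutativeRing : CommutativeRing 0ℓ 0ℓ
  commutativeRing = record { isCommutativeRing = isCommutativeRing }

  open CommutativeRing commutativeRing
    using (_+_; _*_; -_; 0#; 1#; +-comm; +-identityˡ; +-identityʳ; -‿inverseʳ; ring; semiring; +-abelianGroup)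
  open import Algebra.Properties.Ring ring using (-0#≈0#; -‿involutive; -‿distribˡ-*; -‿distribʳ-*)
  open import Algebra.Properties.AbelianGroup +-abelianGroup using (⁻¹-∙-comm)
  open import Algebra.Properties.Semiring.Mult.TCOptimised semiring using (×-homo-+; ×1-homo-*; 1+×) renaming (_×_ to _×ᵣ_)
  open import Tactic.RingSolver.NonReflective (TACR.fromCommutativeRing commutativeRing (λ _ → nothing))
    using (_⊕_; ⊝_; _⊜_) renaming (solve to solve′)

  -- This _×ᵣ_ has 1 ×ᵣ x = x, so ⟦ + 1 ⟧ is 1# itself.
  ⟦_⟧ : ℤ → A
  ⟦ + n      ⟧ = n ×ᵣ 1#
  ⟦ -[1+ n ] ⟧ = - (suc n ×ᵣ 1#)

  -‿homo : ∀ i → ⟦ ℤ.- i ⟧ ≡ - ⟦ i ⟧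
  -‿homo (+ zero)  = sym -0#≈0#
  -‿homo (+ suc n) = refl
  -‿homo -[1+ n ]  = sym (-‿involutive _)

  ⊖-homo : ∀ m n → ⟦ m ⊖ n ⟧ ≡ m ×ᵣ 1# + - (n ×ᵣ 1#)
  ⊖-homo m       zero    rewrite ℤₚ.⊖-≥ (ℕ.z≤n {m}) | -0#≈0# = sym (+-identityʳ (m ×ᵣ 1#))
  ⊖-homo zero    (suc n) rewrite ℤₚ.⊖-< (ℕ.s≤s (ℕ.z≤n {n})) = sym (+-identityˡ _)
  ⊖-homo (suc m) (suc n) rewrite ℤₚ.[1+m]⊖[1+n]≡m⊖n m n | ⊖-homo m n | 1+× m 1# | 1+× n 1# = sym (begin
    (1# + x) + - (1# + y)      ≡⟨ solve′ 3 (λ o x y → ((o ⊕ x) ⊕ ⊝ (o ⊕ y)) ⊜ ((o ⊕ ⊝ o) ⊕ (x ⊕ ⊝ y))) refl 1# x y ⟩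
    (1# + - 1#) + (x + - y)    ≡⟨ cong (_+ (x + - y)) (-‿inverseʳ 1#) ⟩
    0# + (x + - y)             ≡⟨ +-identityˡ (x + - y) ⟩
    x + - y                    ∎)
    where
    x y : A
    x = m ×ᵣ 1#
    y = n ×ᵣ 1#

  +-homo : ∀ i j → ⟦ i ℤ.+ j ⟧ ≡ ⟦ i ⟧ + ⟦ j ⟧
  +-homo (+ m)    (+ n)    = ×-homo-+ 1# m n
  +-homo (+ m)    -[1+ n ] = ⊖-homo m (suc n)
  +-homo -[1+ m ] (+ n)    = trans (⊖-homo n (suc m)) (+-comm _ _)
  +-homo -[1+ m ] -[1+ n ] = begin
    - (suc (suc (m ℕ.+ n)) ×ᵣ 1#)   ≡⟨ cong (λ k → - (suc k ×ᵣ 1#)) (ℕₚ.+-suc m n) ⟨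
    - ((suc m ℕ.+ suc n) ×ᵣ 1#)     ≡⟨ cong -_ (×-homo-+ 1# (suc m) (suc n)) ⟩
    - (suc m ×ᵣ 1# + suc n ×ᵣ 1#)    ≡⟨ ⁻¹-∙-comm _ _ ⟨
    - (suc m ×ᵣ 1#) + - (suc n ×ᵣ 1#) ∎

  *-homo : ∀ i j → ⟦ i ℤ.* j ⟧ ≡ ⟦ i ⟧ * ⟦ j ⟧
  *-homo (+ m)    j        = +*-homo m j
    where
    +*-homo : ∀ m j → ⟦ + m ℤ.* j ⟧ ≡ ⟦ + m ⟧ * ⟦ j ⟧
    +*-homo m (+ n)    rewrite sym (ℤₚ.pos-* m n) = ×1-homo-* m n
    +*-homo m -[1+ n ] rewrite sym (ℤₚ.neg-distribʳ-* (+ m) (+ suc n)) | sym (ℤₚ.pos-* m (suc n)) =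
      trans (-‿homo (+ (m ℕ.* suc n))) (trans (cong -_ (×1-homo-* m (suc n))) (-‿distribʳ-* _ _))
  *-homo -[1+ m ] j rewrite sym (ℤₚ.neg-distribˡ-* (+ suc m) j) =
    trans (-‿homo (+ suc m ℤ.* j)) (trans (cong -_ (*-homo (+ suc m) j)) (-‿distribˡ-* _ _))

  morphism : ℤ.+-*-rawRing -Raw-AlmostCommutative⟶ ACR.fromCommutativeRing commutativeRing
  morphism = record { ⟦_⟧ = ⟦_⟧ ; +-homo = +-homo ; *-homo = *-homo ; -‿homo = -‿homo
                    ; 0-homo = refl ; 1-homo = refl }

  open import Algebra.Solver.Ring ℤ.+-*-rawRing (ACR.fromCommutativeRing commutativeRing) morphism
    (λ i j → Maybe.map (cong ⟦_⟧) (dec⇒maybe (i ℤ.≟ j)))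
    public using (Polynomial; solve; _:=_; _:+_; _:*_; :-_; _:-_; con)

  :0# :1# : ∀ {n} → Polynomial n
  :0# = con (+ 0)
  :1# = con (+ 1)

module FieldProperties {q : ℕ} (F : FiniteField q) where

  open FiniteField F public using (Carrier)
  open FiniteField F using (isCommutativeRing; inverse; card)
  open ℤ-Solver isCommutativeRing public
  open CommutativeRing commutativeRing public
    using (_+_; _*_; -_; _-_; 0#; 1#; -‿inverseʳ; +-identityˡ; +-identityʳ; *-identityˡ; *-comm; *-assoc; zeroˡ; zeroʳ; semiring; ring)
  open import Algebra.Properties.Ring ring public using (-‿distribˡ-*)

  _≟_ : DecidableEquality Carrier
  _≟_ = Finₚ.inj⇒≟ (↔⇒↣ card)

  HasCard-Carrier : HasCard (U {A = Carrier}) q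
  HasCard-Carrier =
    HasCard-resp-≐ (_ , λ {x} _ → Inverse.to card x , _ , Inverse.strictlyInverseʳ card x)
                   (HasCard-image (Inverse.from card) (λ _ _ → Injection.injective (↔⇒↣ (↔-sym card))) (HasCard-Fin q))

  HasCard-nonzero : HasCard (∁ (_≡ 0#)) (q ℕ.∸ 1)
  HasCard-nonzero = HasCard-∁ (_≟ 0#) HasCard-Carrier (HasCard-resp-≐ (sym , sym) (HasCard-singleton 0#))

  -- The junk value 0# ⁻¹ = 0# makes the inverse a total function.
  _⁻¹ : Carrier → Carrier
  x ⁻¹ with x ≟ 0#
  ... | yes _   = 0#
  ... | no x≢0 = proj₁ (inverse x x≢0)

  ⁻¹-inverseʳ : ∀ {x} → x ≢ 0# → x * x ⁻¹ ≡ 1#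
  ⁻¹-inverseʳ {x} x≢0 with x ≟ 0#
  ... | yes x≡0 = ⊥-elim (x≢0 x≡0)
  ... | no x≢0′ = proj₂ (inverse x x≢0′)

  VanishOn : ∀ {k} → Pred (Fin k) 0ℓ → Pred (Vec Carrier k) 0ℓ
  VanishOn Z v = ∀ j → Z j → lookup v j ≡ 0#

  private
    HasCard-VanishOn-∷ : ∀ {k h g} {Z : Pred (Fin (suc k)) 0ℓ} →
                         HasCard (λ x → Z zero → x ≡ 0#) h → HasCard (VanishOn (Z ∘ suc)) g →
                         HasCard (VanishOn Z) (h ℕ.* g)
    HasCard-VanishOn-∷ heads tails =
      HasCard-resp-≐ ((λ { ((x , v) , (x≡0 , v≡0) , refl) → λ { zero → x≡0 ; (suc j) → v≡0 j } }) ,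
                      (λ { {x ∷ v} xv≡0 → (x , v) , (xv≡0 zero , xv≡0 ∘ suc) , refl }))
                     (HasCard-image (uncurry _∷_) (λ { _ _ refl → refl }) (HasCard-× heads tails))

  HasCard-VanishOn : ∀ {k f} {Z : Pred (Fin k) 0ℓ} → Decidable Z → HasCard (∁ Z) f → HasCard (VanishOn Z) (q ^ f)
  HasCard-VanishOn {zero} Z? ∁Z rewrite HasCard-unique ∁Z (HasCard-empty λ ()) =
    HasCard-resp-≐ ((λ { refl () }) , λ { {[]} _ → refl }) (HasCard-singleton [])
  HasCard-VanishOn {suc k} {f} {Z} Z? ∁Z
    with f′ , ∁Z∘suc ← HasCard-decidable (¬? ∘ Z? ∘ suc) (HasCard-Fin k) | Z? zero
  ... | yes Z0 rewrite HasCard-unique ∁Z (HasCard-skip ∁Z∘suc (λ ¬Z0 → ¬Z0 Z0)) =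
    subst (HasCard _) (ℕₚ.*-identityˡ _)
      (HasCard-VanishOn-∷ (HasCard-resp-≐ ((λ { refl _ → refl }) , (λ x≡0 → sym (x≡0 Z0))) (HasCard-singleton 0#))
                          (HasCard-VanishOn (Z? ∘ suc) ∁Z∘suc))
  ... | no ¬Z0 rewrite HasCard-unique ∁Z (HasCard-cons ∁Z∘suc ¬Z0) =
    HasCard-VanishOn-∷ (HasCard-resp-≐ ((λ _ Z0 → ⊥-elim (¬Z0 Z0)) , _) HasCard-Carrier)
                       (HasCard-VanishOn (Z? ∘ suc) ∁Z∘suc)

module MatrixProperties {q : ℕ} (F : FiniteField q) where

  open FieldProperties F
  open import Algebra.Properties.Semiring.Sum semiring public
    using (sum; sum-cong-≗; sum-remove; sum-permute; sum-replicate-zero; ∑-distrib-+; ∑-comm; *-distribˡ-sum; *-distribʳ-sum)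

  fromFun : ∀ {m} → (Fin m → Fin m → Carrier) → Mat F m
  fromFun f = tabulate λ r → tabulate (f r)

  entry-fromFun : ∀ {m} (f : Fin m → Fin m → Carrier) r c → entry F (fromFun f) r c ≡ f r c
  entry-fromFun f r c rewrite lookup∘tabulate (tabulate ∘ f) r = lookup∘tabulate (f r) c

  ≡-fromEntries : ∀ {m} {A B : Mat F m} → (∀ r c → entry F A r c ≡ entry F B r c) → A ≡ B
  ≡-fromEntries {A = A} {B} A≗B = begin
    A                               ≡⟨ tabulate-entries A ⟨
    tabulate (tabulate ∘ entry F A) ≡⟨ tabulate-cong (λ r → tabulate-cong (A≗B r)) ⟩
    tabulate (tabulate ∘ entry F B) ≡⟨ tabulate-entries B ⟩
    B                               ∎
    where
    tabulate-entries : ∀ {m} (A : Mat F m) → tabulate (tabulate ∘ entry F A) ≡ A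
    tabulate-entries A = trans (tabulate-cong (tabulate∘lookup ∘ lookup A)) (tabulate∘lookup A)

  sumF≡sum : ∀ {m} (f : Fin m → Carrier) → sumF F f ≡ sum f
  sumF≡sum {zero}  f = refl
  sumF≡sum {suc m} f = cong (f zero +_) (sumF≡sum (f ∘ suc))

  entry-· : ∀ {m} (A B : Mat F m) r c → entry F (_·_ F A B) r c ≡ sum λ k → entry F A r k * entry F B k c
  entry-· A B r c =
    trans (entry-fromFun (λ r c → sumF F λ k → entry F A r k * entry F B k c) r c)
          (sumF≡sum λ k → entry F A r k * entry F B k c)

  entry-·-split : ∀ {m} (A B : Mat F (suc m)) K r c →
                  entry F (_·_ F A B) r c ≡
                  entry F A r K * entry F B K c + sum λ k → entry F A r (punchIn K k) * entry F B (punchIn K k) c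
  entry-·-split A B K r c = trans (entry-· A B r c) (sum-remove {i = K} λ k → entry F A r k * entry F B k c)

  private
    -- Names the Kronecker delta that is local to the definition of `identity` in Defs.
    kronecker : ∀ {m} → Σ (Fin m → Fin m → Carrier) λ δ → identity F ≡ fromFun δ
    kronecker = _ , refl

    entry-identity : ∀ {m} (r c : Fin m) → entry F (identity F) r c ≡ proj₁ kronecker r c
    entry-identity = entry-fromFun (proj₁ kronecker)

    entry-identity-suc : ∀ {m} (r c : Fin m) → entry F (identity F) (suc r) (suc c) ≡ entry F (identity F) r c
    entry-identity-suc r c = trans (entry-identity (suc r) (suc c)) (sym (entry-identity r c))

  identity-diagonal : ∀ {m} (r : Fin m) → entry F (identity F) r r ≡ 1#
  identity-diagonal {suc m} zero    = entry-identity {suc m} zero zero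
  identity-diagonal {suc m} (suc r) = trans (entry-identity-suc r r) (identity-diagonal r)

  identity-offDiagonal : ∀ {m} {r c : Fin m} → r ≢ c → entry F (identity F) r c ≡ 0#
  identity-offDiagonal {suc m} {zero}  {zero}  r≢c = ⊥-elim (r≢c refl)
  identity-offDiagonal {suc m} {zero}  {suc c} r≢c = entry-identity {suc m} zero (suc c)
  identity-offDiagonal {suc m} {suc r} {zero}  r≢c = entry-identity {suc m} (suc r) zero
  identity-offDiagonal {suc m} {suc r} {suc c} r≢c =
    trans (entry-identity-suc r c) (identity-offDiagonal (r≢c ∘ cong suc))

  private
    sum-zero : ∀ {m} {f : Fin m → Carrier} → (∀ k → f k ≡ 0#) → sum f ≡ 0#
    sum-zero {m} f≡0 = trans (sum-cong-≗ f≡0) (sum-replicate-zero m)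

  ∑-identityˡ : ∀ {m} (r : Fin m) (g : Fin m → Carrier) → (sum λ k → entry F (identity F) r k * g k) ≡ g r
  ∑-identityˡ {suc m} r g = begin
    (sum λ k → I r k * g k)                                 ≡⟨ sum-remove {i = r} (λ k → I r k * g k) ⟩
    I r r * g r + (sum λ k → I r (punchIn r k) * g (punchIn r k))
      ≡⟨ cong₂ _+_ (trans (cong (_* g r) (identity-diagonal r)) (*-identityˡ (g r)))
                   (sum-zero λ k → trans (cong (_* _) (identity-offDiagonal (Finₚ.punchInᵢ≢i r k ∘ sym))) (zeroˡ _)) ⟩
    g r + 0#                                                ≡⟨ +-identityʳ (g r) ⟩
    g r                                                     ∎
    where
    I : Fin (suc m) → Fin (suc m) → Carrier
    I = entry F (identity F)

  ∑-identityʳ : ∀ {m} (c : Fin m) (g : Fin m → Carrier) → (sum λ k → g k * entry F (identity F) k c) ≡ g c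
  ∑-identityʳ c g = trans (sum-cong-≗ λ k → trans (*-comm (g k) _) (cong (_* g k) (identity-symmetric k c))) (∑-identityˡ c g)
    where
    identity-symmetric : ∀ {m} (r c : Fin m) → entry F (identity F) r c ≡ entry F (identity F) c r
    identity-symmetric r c with r Finₚ.≟ c
    ... | yes refl = refl
    ... | no r≢c  = trans (identity-offDiagonal r≢c) (sym (identity-offDiagonal (r≢c ∘ sym)))

  identity-injective : ∀ {m n} (f : Fin m → Fin n) → (∀ {a b} → f a ≡ f b → a ≡ b) →
                       ∀ r c → entry F (identity F) (f r) (f c) ≡ entry F (identity F) r c
  identity-injective f f-injective r c with r Finₚ.≟ c
  ... | yes refl = trans (identity-diagonal (f r)) (sym (identity-diagonal r))
  ... | no r≢c  = trans (identity-offDiagonal (r≢c ∘ f-injective)) (sym (identity-offDiagonal r≢c))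

  identity-punchIn : ∀ {n} (K : Fin (suc n)) (r c : Fin n) →
                     entry F (identity F) (punchIn K r) (punchIn K c) ≡ entry F (identity F) r c
  identity-punchIn K = identity-injective (punchIn K) (λ {a} {b} → Finₚ.punchIn-injective K a b)

  identity-pivot-punchIn : ∀ {n} (K : Fin (suc n)) (r : Fin n) → entry F (identity F) K (punchIn K r) ≡ 0#
  identity-pivot-punchIn K r = identity-offDiagonal (Finₚ.punchInᵢ≢i K r ∘ sym)

  identity-punchIn-pivot : ∀ {n} (K : Fin (suc n)) (r : Fin n) → entry F (identity F) (punchIn K r) K ≡ 0#
  identity-punchIn-pivot K r = identity-offDiagonal (Finₚ.punchInᵢ≢i K r)

  ≡identity-fromSums : ∀ {m} {A B : Mat F m} →
                       (∀ r c → (sum λ k → entry F A r k * entry F B k c) ≡ entry F (identity F) r c) →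
                       _·_ F A B ≡ identity F
  ≡identity-fromSums {A = A} {B} sums = ≡-fromEntries λ r c → trans (entry-· A B r c) (sums r c)

  ∑-assoc : ∀ {m n} (f : Fin m → Carrier) (g : Fin m → Fin n → Carrier) (h : Fin n → Carrier) →
            (sum λ c → f c * sum λ r → g c r * h r) ≡ (sum λ r → (sum λ c → f c * g c r) * h r)
  ∑-assoc f g h = begin
    (sum λ c → f c * sum λ r → g c r * h r)    ≡⟨ sum-cong-≗ (λ c → *-distribˡ-sum (f c) (λ r → g c r * h r)) ⟩
    (sum λ c → sum λ r → f c * (g c r * h r))  ≡⟨ sum-cong-≗ (λ c → sum-cong-≗ λ r → sym (*-assoc (f c) (g c r) (h r))) ⟩
    (sum λ c → sum λ r → f c * g c r * h r)    ≡⟨ ∑-comm (λ c r → f c * g c r * h r) ⟩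
    (sum λ r → sum λ c → f c * g c r * h r)    ≡⟨ sum-cong-≗ (λ r → *-distribʳ-sum (h r) (λ c → f c * g c r)) ⟨
    (sum λ r → (sum λ c → f c * g c r) * h r)  ∎

  ∑-sub : ∀ {m} (f g : Fin m → Carrier) (x : Carrier) → (sum λ k → f k - x * g k) ≡ sum f - x * sum g
  ∑-sub f g x = begin
    (sum λ k → f k - x * g k)         ≡⟨ ∑-distrib-+ f (λ k → - (x * g k)) ⟩
    sum f + (sum λ k → - (x * g k))   ≡⟨ cong (sum f +_) (sum-cong-≗ λ k → -‿distribˡ-* x (g k)) ⟩
    sum f + (sum λ k → - x * g k)     ≡⟨ cong (sum f +_) (*-distribˡ-sum (- x) g) ⟨
    sum f + - x * sum g               ≡⟨ cong (sum f +_) (-‿distribˡ-* x (sum g)) ⟨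
    sum f - x * sum g                 ∎

  ∑-factor : ∀ {m} (f g : Fin m → Carrier) (x : Carrier) → (∀ k → f k ≡ x * g k) → sum f ≡ x * sum g
  ∑-factor f g x f≗xg = trans (sum-cong-≗ f≗xg) (sym (*-distribˡ-sum x g))

  ∑-linear : ∀ {m} (f g h : Fin m → Carrier) (x y : Carrier) →
             (∀ k → f k ≡ x * g k + y * h k) → sum f ≡ x * sum g + y * sum h
  ∑-linear f g h x y f≗xg+yh = begin
    sum f                                          ≡⟨ sum-cong-≗ f≗xg+yh ⟩
    (sum λ k → x * g k + y * h k)                  ≡⟨ ∑-distrib-+ (λ k → x * g k) (λ k → y * h k) ⟩
    (sum λ k → x * g k) + (sum λ k → y * h k)      ≡⟨ cong₂ _+_ (*-distribˡ-sum x g) (*-distribˡ-sum y h) ⟨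
    x * sum g + y * sum h                          ∎

  permuteRows : ∀ {m} → Permutation′ m → Mat F m → Mat F m
  permuteRows π A = fromFun λ r c → entry F A (π ⟨$⟩ʳ r) c

  entry-permuteRows : ∀ {m} (π : Permutation′ m) (A : Mat F m) r c → entry F (permuteRows π A) r c ≡ entry F A (π ⟨$⟩ʳ r) c
  entry-permuteRows π A = entry-fromFun λ r c → entry F A (π ⟨$⟩ʳ r) c

  permuteRows-involutive : ∀ {m} (π : Permutation′ m) → (∀ r → π ⟨$⟩ʳ (π ⟨$⟩ʳ r) ≡ r) →
                           (A : Mat F m) → permuteRows π (permuteRows π A) ≡ A
  permuteRows-involutive π π∘π A = ≡-fromEntries λ r c → begin
    entry F (permuteRows π (permuteRows π A)) r c ≡⟨ entry-permuteRows π (permuteRows π A) r c ⟩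
    entry F (permuteRows π A) (π ⟨$⟩ʳ r) c        ≡⟨ entry-permuteRows π A (π ⟨$⟩ʳ r) c ⟩
    entry F A (π ⟨$⟩ʳ (π ⟨$⟩ʳ r)) c               ≡⟨ cong (λ r′ → entry F A r′ c) (π∘π r) ⟩
    entry F A r c                                 ∎

  permuteRows-invertible : ∀ {m} (π : Permutation′ m) {A : Mat F m} → Invertible F A → Invertible F (permuteRows π A)
  permuteRows-invertible {m} π {A} (B , AB≡I , BA≡I) =
    B′ , ≡identity-fromSums {A = permuteRows π A} {B′} A′B′ , ≡identity-fromSums {A = B′} {permuteRows π A} B′A′
    where
    π̂ : Fin m → Fin m
    π̂ = π ⟨$⟩ʳ_

    B′ : Mat F m
    B′ = fromFun λ r c → entry F B r (π̂ c)

    A′B′ : ∀ r c → (sum λ k → entry F (permuteRows π A) r k * entry F B′ k c) ≡ entry F (identity F) r c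
    A′B′ r c = begin
      (sum λ k → entry F (permuteRows π A) r k * entry F B′ k c)
        ≡⟨ sum-cong-≗ (λ k → cong₂ _*_ (entry-fromFun _ r k) (entry-fromFun _ k c)) ⟩
      (sum λ k → entry F A (π̂ r) k * entry F B k (π̂ c))  ≡⟨ entry-· A B (π̂ r) (π̂ c) ⟨
      entry F (_·_ F A B) (π̂ r) (π̂ c)                     ≡⟨ cong (λ M → entry F M (π̂ r) (π̂ c)) AB≡I ⟩
      entry F (identity F) (π̂ r) (π̂ c)                    ≡⟨ identity-injective π̂ (Injection.injective (↔⇒↣ π)) r c ⟩
      entry F (identity F) r c                            ∎

    B′A′ : ∀ r c → (sum λ k → entry F B′ r k * entry F (permuteRows π A) k c) ≡ entry F (identity F) r c
    B′A′ r c = begin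
      (sum λ k → entry F B′ r k * entry F (permuteRows π A) k c)
        ≡⟨ sum-cong-≗ (λ k → cong₂ _*_ (entry-fromFun _ r k) (entry-fromFun _ k c)) ⟩
      (sum λ k → entry F B r (π̂ k) * entry F A (π̂ k) c)  ≡⟨ sum-permute (λ k → entry F B r k * entry F A k c) π ⟨
      (sum λ k → entry F B r k * entry F A k c)          ≡⟨ entry-· B A r c ⟨
      entry F (_·_ F B A) r c                            ≡⟨ cong (λ M → entry F M r c) BA≡I ⟩
      entry F (identity F) r c                           ∎

-- Block decomposition at a pivot and the Schur complement

data PunchInView {m : ℕ} (P : Fin (suc m)) : Fin (suc m) → Set where
  here  : PunchInView P P
  there : (r : Fin m) → PunchInView P (punchIn P r)

punchInView : ∀ {m} (P R : Fin (suc m)) → PunchInView P R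
punchInView P R with P Finₚ.≟ R
... | yes refl = here
... | no P≢R  = subst (PunchInView P) (Finₚ.punchIn-punchOut P≢R) (there (punchOut P≢R))

module Block {X : Set} {m : ℕ} (P Q : Fin (suc m)) where

  block : X → (Fin m → X) → (Fin m → X) → (Fin m → Fin m → X) → Fin (suc m) → Fin (suc m) → X
  block a u v M = insertAt (λ r → insertAt (M r) Q (v r)) P (insertAt u Q a)

  module _ (a : X) (u v : Fin m → X) (M : Fin m → Fin m → X) where
    block-pivot : block a u v M P Q ≡ a
    block-pivot rewrite insertAt-lookup (λ r → insertAt (M r) Q (v r)) P (insertAt u Q a) = insertAt-lookup u Q a

    block-row : ∀ c → block a u v M P (punchIn Q c) ≡ u c
    block-row c rewrite insertAt-lookup (λ r → insertAt (M r) Q (v r)) P (insertAt u Q a) = insertAt-punchIn u Q a c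

    block-column : ∀ r → block a u v M (punchIn P r) Q ≡ v r
    block-column r rewrite insertAt-punchIn (λ r → insertAt (M r) Q (v r)) P (insertAt u Q a) r =
      insertAt-lookup (M r) Q (v r)

    block-minor : ∀ r c → block a u v M (punchIn P r) (punchIn Q c) ≡ M r c
    block-minor r c rewrite insertAt-punchIn (λ r → insertAt (M r) Q (v r)) P (insertAt u Q a) r =
      insertAt-punchIn (M r) Q (v r) c

  block-cong : ∀ {a a′ u u′ v v′ M M′} → a ≡ a′ → u ≗ u′ → v ≗ v′ → (∀ r c → M r c ≡ M′ r c) →
               ∀ R C → block a u v M R C ≡ block a′ u′ v′ M′ R C
  block-cong {a} {a′} {u} {u′} {v} {v′} {M} {M′} a≡a′ u≗u′ v≗v′ M≗M′ R C
    with punchInView P R | punchInView Q C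
  ... | here    | here    = trans (block-pivot a u v M) (trans a≡a′ (sym (block-pivot a′ u′ v′ M′)))
  ... | here    | there c = trans (block-row a u v M c) (trans (u≗u′ c) (sym (block-row a′ u′ v′ M′ c)))
  ... | there r | here    = trans (block-column a u v M r) (trans (v≗v′ r) (sym (block-column a′ u′ v′ M′ r)))
  ... | there r | there c = trans (block-minor a u v M r c) (trans (M≗M′ r c) (sym (block-minor a′ u′ v′ M′ r c)))

module Pivoting {q : ℕ} (F : FiniteField q) {m : ℕ} (P Q : Fin (suc m)) where

  open FieldProperties F
  open MatrixProperties F
  open Block {X = Carrier} P Q

  module _ (A : Mat F (suc m)) where

    pivot : Carrier
    pivot = entry F A P Q

    pivotRow : Fin m → Carrier
    pivotRow c = entry F A P (punchIn Q c)

    pivotColumn : Fin m → Carrier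
    pivotColumn r = entry F A (punchIn P r) Q

    minor : Fin m → Fin m → Carrier
    minor r c = entry F A (punchIn P r) (punchIn Q c)

    schur : Fin m → Fin m → Carrier
    schur r c = minor r c - pivotColumn r * pivotRow c * pivot ⁻¹

    entry≡block : ∀ R C → entry F A R C ≡ block pivot pivotRow pivotColumn minor R C
    entry≡block R C with punchInView P R | punchInView Q C
    ... | here    | here    = sym (block-pivot _ _ _ _)
    ... | here    | there c = sym (block-row _ _ _ _ c)
    ... | there r | here    = sym (block-column _ _ _ _ r)
    ... | there r | there c = sym (block-minor _ _ _ _ r c)

  module _ (a : Carrier) (u v : Fin m → Carrier) (M : Fin m → Fin m → Carrier) where

    pivot-block : pivot (fromFun (block a u v M)) ≡ a
    pivot-block = trans (entry-fromFun (block a u v M) P Q) (block-pivot a u v M)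

    pivotRow-block : ∀ c → pivotRow (fromFun (block a u v M)) c ≡ u c
    pivotRow-block c = trans (entry-fromFun (block a u v M) P (punchIn Q c)) (block-row a u v M c)

    pivotColumn-block : ∀ r → pivotColumn (fromFun (block a u v M)) r ≡ v r
    pivotColumn-block r = trans (entry-fromFun (block a u v M) (punchIn P r) Q) (block-column a u v M r)

    minor-block : ∀ r c → minor (fromFun (block a u v M)) r c ≡ M r c
    minor-block r c = trans (entry-fromFun (block a u v M) (punchIn P r) (punchIn Q c)) (block-minor a u v M r c)

  private
    I : ∀ {n} → Fin n → Fin n → Carrier
    I = entry F (identity F)

    -- Eliminating y between two linear equations, with t = p⁻¹.
    eliminate : ∀ {p t x y s₁ s₂ d} → p * t ≡ 1# → x * y + s₁ ≡ d → p * y + s₂ ≡ 0# → s₁ - x * t * s₂ ≡ d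
    eliminate {p} {t} {x} {y} {s₁} {s₂} pt≡1 refl py+s₂≡0 = begin
      s₁ - x * t * s₂
        ≡⟨ solve 6 (λ p t x y s₁ s₂ → s₁ :- x :* t :* s₂
                    := x :* y :+ s₁ :- x :* t :* (p :* y :+ s₂) :+ x :* y :* (p :* t) :- x :* y) refl p t x y s₁ s₂ ⟩
      x * y + s₁ - x * t * (p * y + s₂) + x * y * (p * t) - x * y
        ≡⟨ cong₂ (λ a b → x * y + s₁ - x * t * a + x * y * b - x * y) py+s₂≡0 pt≡1 ⟩
      x * y + s₁ - x * t * 0# + x * y * 1# - x * y
        ≡⟨ solve 4 (λ t x y s₁ → x :* y :+ s₁ :- x :* t :* :0# :+ x :* y :* :1# :- x :* y := x :* y :+ s₁) refl t x y s₁ ⟩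
      x * y + s₁ ∎

  schur-invertible : ∀ {A} → pivot A ≢ 0# → Invertible F A → Invertible F (fromFun (schur A))
  schur-invertible {A} p≢0 (B , AB≡I , BA≡I) =
    T , ≡identity-fromSums {A = S} {T} ST≡I , ≡identity-fromSums {A = T} {S} TS≡I
    where
    t : Carrier
    t = pivot A ⁻¹

    u v : Fin m → Carrier
    u = pivotRow A
    v = pivotColumn A

    S : Mat F m
    S = fromFun (schur A)

    B̂ : Fin m → Fin m → Carrier
    B̂ c r = entry F B (punchIn Q c) (punchIn P r)

    T : Mat F m
    T = fromFun B̂

    AB : ∀ R C → entry F A R Q * entry F B Q C + (sum λ c → entry F A R (punchIn Q c) * entry F B (punchIn Q c) C) ≡ I R C
    AB R C = trans (sym (entry-·-split A B Q R C)) (cong (λ M → entry F M R C) AB≡I)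

    BA : ∀ R C → entry F B R P * entry F A P C + (sum λ r → entry F B R (punchIn P r) * entry F A (punchIn P r) C) ≡ I R C
    BA R C = trans (sym (entry-·-split B A P R C)) (cong (λ M → entry F M R C) BA≡I)

    ST≡I : ∀ r r′ → (sum λ c → entry F S r c * entry F T c r′) ≡ I r r′
    ST≡I r r′ = begin
      (sum λ c → entry F S r c * entry F T c r′)
        ≡⟨ sum-cong-≗ (λ c → trans (cong₂ _*_ (entry-fromFun (schur A) r c) (entry-fromFun B̂ c r′))
                                    (solve 5 (λ a v u t b → (a :- v :* u :* t) :* b := a :* b :- v :* t :* (u :* b))
                                             refl (minor A r c) (v r) (u c) t (B̂ c r′))) ⟩
      (sum λ c → minor A r c * B̂ c r′ - v r * t * (u c * B̂ c r′))
        ≡⟨ ∑-sub (λ c → minor A r c * B̂ c r′) (λ c → u c * B̂ c r′) (v r * t) ⟩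
      (sum λ c → minor A r c * B̂ c r′) - v r * t * (sum λ c → u c * B̂ c r′)
        ≡⟨ eliminate (⁻¹-inverseʳ p≢0) (trans (AB (punchIn P r) (punchIn P r′)) (identity-punchIn P r r′))
                                       (trans (AB P (punchIn P r′)) (identity-pivot-punchIn P r′)) ⟩
      I r r′ ∎

    TS≡I : ∀ c c′ → (sum λ r → entry F T c r * entry F S r c′) ≡ I c c′
    TS≡I c c′ = begin
      (sum λ r → entry F T c r * entry F S r c′)
        ≡⟨ sum-cong-≗ (λ r → trans (cong₂ _*_ (entry-fromFun B̂ c r) (entry-fromFun (schur A) r c′))
                                    (solve 5 (λ b a v u t → b :* (a :- v :* u :* t) := b :* a :- u :* t :* (b :* v))
                                             refl (B̂ c r) (minor A r c′) (v r) (u c′) t)) ⟩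
      (sum λ r → B̂ c r * minor A r c′ - u c′ * t * (B̂ c r * v r))
        ≡⟨ ∑-sub (λ r → B̂ c r * minor A r c′) (λ r → B̂ c r * v r) (u c′ * t) ⟩
      (sum λ r → B̂ c r * minor A r c′) - u c′ * t * (sum λ r → B̂ c r * v r)
        ≡⟨ eliminate (⁻¹-inverseʳ p≢0)
             (trans (cong (_+ (sum λ r → B̂ c r * minor A r c′)) (*-comm (u c′) (entry F B (punchIn Q c) P)))
                    (trans (BA (punchIn Q c) (punchIn Q c′)) (identity-punchIn Q c c′)))
             (trans (cong (_+ (sum λ r → B̂ c r * v r)) (*-comm (pivot A) (entry F B (punchIn Q c) P)))
                    (trans (BA (punchIn Q c) Q) (identity-punchIn-pivot Q c))) ⟩
      I c c′ ∎

  module BlockInverse {p : Carrier} (p≢0 : p ≢ 0#) (u v : Fin m → Carrier) {S T : Mat F m}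
                      (ST≡I : _·_ F S T ≡ identity F) (TS≡I : _·_ F T S ≡ identity F) where

    private
      t : Carrier
      t = p ⁻¹

      pt≡1 : p * t ≡ 1#
      pt≡1 = ⁻¹-inverseʳ p≢0

      M : Fin m → Fin m → Carrier
      M r c = entry F S r c + v r * u c * t

      α β : Fin m → Carrier
      α r = sum λ c → u c * entry F T c r
      β c = sum λ r → entry F T c r * v r

      γ : Carrier
      γ = sum λ c → u c * β c

      A : Mat F (suc m)
      A = fromFun (block p u v M)

      module Transposed = Block {X = Carrier} Q P

      B-entries : Fin (suc m) → Fin (suc m) → Carrier
      B-entries = Transposed.block (t + t * t * γ) (λ r → - (t * α r)) (λ c → - (t * β c)) (entry F T)

      B : Mat F (suc m)
      B = fromFun B-entries

      A-pivot : entry F A P Q ≡ p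
      A-pivot = pivot-block p u v M
      A-row : ∀ c → entry F A P (punchIn Q c) ≡ u c
      A-row = pivotRow-block p u v M
      A-column : ∀ r → entry F A (punchIn P r) Q ≡ v r
      A-column = pivotColumn-block p u v M
      A-minor : ∀ r c → entry F A (punchIn P r) (punchIn Q c) ≡ M r c
      A-minor = minor-block p u v M

      B-pivot : entry F B Q P ≡ t + t * t * γ
      B-pivot = trans (entry-fromFun B-entries Q P) (Transposed.block-pivot _ _ _ _)
      B-row : ∀ r → entry F B Q (punchIn P r) ≡ - (t * α r)
      B-row r = trans (entry-fromFun B-entries Q (punchIn P r)) (Transposed.block-row _ _ _ _ r)
      B-column : ∀ c → entry F B (punchIn Q c) P ≡ - (t * β c)
      B-column c = trans (entry-fromFun B-entries (punchIn Q c) P) (Transposed.block-column _ _ _ _ c)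
      B-minor : ∀ c r → entry F B (punchIn Q c) (punchIn P r) ≡ entry F T c r
      B-minor c r = trans (entry-fromFun B-entries (punchIn Q c) (punchIn P r)) (Transposed.block-minor _ _ _ _ c r)

      ST : ∀ r r′ → (sum λ c → entry F S r c * entry F T c r′) ≡ I r r′
      ST r r′ = trans (sym (entry-· S T r r′)) (cong (λ X → entry F X r r′) ST≡I)

      TS : ∀ c c′ → (sum λ r → entry F T c r * entry F S r c′) ≡ I c c′
      TS c c′ = trans (sym (entry-· T S c c′)) (cong (λ X → entry F X c c′) TS≡I)

      Sβ≡v : ∀ r → (sum λ c → entry F S r c * β c) ≡ v r
      Sβ≡v r = begin
        (sum λ c → entry F S r c * β c)                                 ≡⟨ ∑-assoc (entry F S r) (entry F T) v ⟩
        (sum λ r′ → (sum λ c → entry F S r c * entry F T c r′) * v r′)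
          ≡⟨ sum-cong-≗ (λ r′ → cong (_* v r′) (ST r r′)) ⟩
        (sum λ r′ → I r r′ * v r′)                                      ≡⟨ ∑-identityˡ r v ⟩
        v r                                                             ∎

      αS≡u : ∀ c′ → (sum λ r → α r * entry F S r c′) ≡ u c′
      αS≡u c′ = begin
        (sum λ r → α r * entry F S r c′)                             ≡⟨ ∑-assoc u (entry F T) (λ r → entry F S r c′) ⟨
        (sum λ c → u c * sum λ r → entry F T c r * entry F S r c′)   ≡⟨ sum-cong-≗ (λ c → cong (u c *_) (TS c c′)) ⟩
        (sum λ c → u c * I c c′)                                     ≡⟨ ∑-identityʳ c′ u ⟩
        u c′                                                         ∎

      αv≡γ : (sum λ r → α r * v r) ≡ γ
      αv≡γ = sym (∑-assoc u (entry F T) v)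

      inverse-pivot : p * (t + t * t * γ) + - t * γ ≡ 1#
      inverse-pivot = begin
        p * (t + t * t * γ) + - t * γ    ≡⟨ solve 3 (λ p t γ → p :* (t :+ t :* t :* γ) :+ :- t :* γ
                                                       := p :* t :+ p :* t :* (t :* γ) :- t :* γ) refl p t γ ⟩
        p * t + p * t * (t * γ) - t * γ  ≡⟨ cong (λ x → x + x * (t * γ) - t * γ) pt≡1 ⟩
        1# + 1# * (t * γ) - t * γ        ≡⟨ solve 1 (λ y → :1# :+ :1# :* y :- y := :1#) refl (t * γ) ⟩
        1#                               ∎

      cancel-pivot : ∀ a → p * - (t * a) + a ≡ 0#
      cancel-pivot a = begin
        p * - (t * a) + a     ≡⟨ solve 3 (λ p t a → p :* :- (t :* a) :+ a := :- (p :* t :* a) :+ a) refl p t a ⟩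
        - (p * t * a) + a     ≡⟨ cong (λ x → - (x * a) + a) pt≡1 ⟩
        - (1# * a) + a        ≡⟨ solve 1 (λ a → :- (:1# :* a) :+ a := :0#) refl a ⟩
        0#                    ∎

      expandAB : Fin (suc m) → Fin (suc m) → Carrier
      expandAB R R′ = entry F A R Q * entry F B Q R′ + (sum λ c → entry F A R (punchIn Q c) * entry F B (punchIn Q c) R′)

      expandBA : Fin (suc m) → Fin (suc m) → Carrier
      expandBA C C′ = entry F B C P * entry F A P C′ + (sum λ r → entry F B C (punchIn P r) * entry F A (punchIn P r) C′)

      AB-here-here : expandAB P P ≡ I P P
      AB-here-here = begin
        expandAB P P
          ≡⟨ cong₂ _+_ (cong₂ _*_ A-pivot B-pivot) (sum-cong-≗ λ c → cong₂ _*_ (A-row c) (B-column c)) ⟩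
        p * (t + t * t * γ) + (sum λ c → u c * - (t * β c))
          ≡⟨ cong (p * (t + t * t * γ) +_)
                  (∑-factor (λ c → u c * - (t * β c)) (λ c → u c * β c) (- t)
                            (λ c → solve 3 (λ u t b → u :* :- (t :* b) := :- t :* (u :* b)) refl (u c) t (β c))) ⟩
        p * (t + t * t * γ) + - t * γ ≡⟨ inverse-pivot ⟩
        1#                            ≡⟨ identity-diagonal P ⟨
        I P P                         ∎

      AB-here-there : ∀ r′ → expandAB P (punchIn P r′) ≡ I P (punchIn P r′)
      AB-here-there r′ = begin
        expandAB P (punchIn P r′)
          ≡⟨ cong₂ _+_ (cong₂ _*_ A-pivot (B-row r′)) (sum-cong-≗ λ c → cong₂ _*_ (A-row c) (B-minor c r′)) ⟩
        p * - (t * α r′) + α r′ ≡⟨ cancel-pivot (α r′) ⟩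
        0#                      ≡⟨ identity-pivot-punchIn P r′ ⟨
        I P (punchIn P r′)      ∎

      AB-there-here : ∀ r → expandAB (punchIn P r) P ≡ I (punchIn P r) P
      AB-there-here r = begin
        expandAB (punchIn P r) P
          ≡⟨ cong₂ _+_ (cong₂ _*_ (A-column r) B-pivot) (sum-cong-≗ λ c → cong₂ _*_ (A-minor r c) (B-column c)) ⟩
        v r * (t + t * t * γ) + (sum λ c → M r c * - (t * β c))
          ≡⟨ cong (v r * (t + t * t * γ) +_)
                  (∑-linear _ (λ c → entry F S r c * β c) (λ c → u c * β c) (- t) (- (t * t * v r))
                     (λ c → solve 5 (λ s w u t b → (s :+ w :* u :* t) :* :- (t :* b)
                                                   := :- t :* (s :* b) :+ :- (t :* t :* w) :* (u :* b))
                                    refl (entry F S r c) (v r) (u c) t (β c))) ⟩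
        v r * (t + t * t * γ) + (- t * (sum λ c → entry F S r c * β c) + - (t * t * v r) * γ)
          ≡⟨ cong (λ x → v r * (t + t * t * γ) + (- t * x + - (t * t * v r) * γ)) (Sβ≡v r) ⟩
        v r * (t + t * t * γ) + (- t * v r + - (t * t * v r) * γ)
          ≡⟨ solve 3 (λ w t γ → w :* (t :+ t :* t :* γ) :+ (:- t :* w :+ :- (t :* t :* w) :* γ) := :0#) refl (v r) t γ ⟩
        0#                 ≡⟨ identity-punchIn-pivot P r ⟨
        I (punchIn P r) P  ∎

      AB-there-there : ∀ r r′ → expandAB (punchIn P r) (punchIn P r′) ≡ I (punchIn P r) (punchIn P r′)
      AB-there-there r r′ = begin
        expandAB (punchIn P r) (punchIn P r′)
          ≡⟨ cong₂ _+_ (cong₂ _*_ (A-column r) (B-row r′)) (sum-cong-≗ λ c → cong₂ _*_ (A-minor r c) (B-minor c r′)) ⟩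
        v r * - (t * α r′) + (sum λ c → M r c * entry F T c r′)
          ≡⟨ cong (v r * - (t * α r′) +_)
                  (∑-linear _ (λ c → entry F S r c * entry F T c r′) (λ c → u c * entry F T c r′) 1# (v r * t)
                     (λ c → solve 5 (λ s w u t b → (s :+ w :* u :* t) :* b := :1# :* (s :* b) :+ w :* t :* (u :* b))
                                    refl (entry F S r c) (v r) (u c) t (entry F T c r′))) ⟩
        v r * - (t * α r′) + (1# * (sum λ c → entry F S r c * entry F T c r′) + v r * t * α r′)
          ≡⟨ cong (λ x → v r * - (t * α r′) + (1# * x + v r * t * α r′)) (ST r r′) ⟩
        v r * - (t * α r′) + (1# * I r r′ + v r * t * α r′)
          ≡⟨ solve 4 (λ w t a d → w :* :- (t :* a) :+ (:1# :* d :+ w :* t :* a) := d) refl (v r) t (α r′) (I r r′) ⟩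
        I r r′                              ≡⟨ identity-punchIn P r r′ ⟨
        I (punchIn P r) (punchIn P r′)      ∎

      BA-here-here : expandBA Q Q ≡ I Q Q
      BA-here-here = begin
        expandBA Q Q
          ≡⟨ cong₂ _+_ (cong₂ _*_ B-pivot A-pivot) (sum-cong-≗ λ r → cong₂ _*_ (B-row r) (A-column r)) ⟩
        (t + t * t * γ) * p + (sum λ r → - (t * α r) * v r)
          ≡⟨ cong₂ _+_ (*-comm _ p)
                   (trans (∑-factor (λ r → - (t * α r) * v r) (λ r → α r * v r) (- t)
                             (λ r → solve 3 (λ t a w → :- (t :* a) :* w := :- t :* (a :* w)) refl t (α r) (v r)))
                          (cong (- t *_) αv≡γ)) ⟩
        p * (t + t * t * γ) + - t * γ ≡⟨ inverse-pivot ⟩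
        1#                            ≡⟨ identity-diagonal Q ⟨
        I Q Q                         ∎

      BA-here-there : ∀ c′ → expandBA Q (punchIn Q c′) ≡ I Q (punchIn Q c′)
      BA-here-there c′ = begin
        expandBA Q (punchIn Q c′)
          ≡⟨ cong₂ _+_ (cong₂ _*_ B-pivot (A-row c′)) (sum-cong-≗ λ r → cong₂ _*_ (B-row r) (A-minor r c′)) ⟩
        (t + t * t * γ) * u c′ + (sum λ r → - (t * α r) * M r c′)
          ≡⟨ cong ((t + t * t * γ) * u c′ +_)
                  (∑-linear _ (λ r → α r * entry F S r c′) (λ r → α r * v r) (- t) (- (t * u c′ * t))
                     (λ r → solve 5 (λ t a s w u → :- (t :* a) :* (s :+ w :* u :* t)
                                                   := :- t :* (a :* s) :+ :- (t :* u :* t) :* (a :* w))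
                                    refl t (α r) (entry F S r c′) (v r) (u c′))) ⟩
        (t + t * t * γ) * u c′ + (- t * (sum λ r → α r * entry F S r c′) + - (t * u c′ * t) * (sum λ r → α r * v r))
          ≡⟨ cong₂ (λ x y → (t + t * t * γ) * u c′ + (- t * x + - (t * u c′ * t) * y)) (αS≡u c′) αv≡γ ⟩
        (t + t * t * γ) * u c′ + (- t * u c′ + - (t * u c′ * t) * γ)
          ≡⟨ solve 3 (λ u t γ → (t :+ t :* t :* γ) :* u :+ (:- t :* u :+ :- (t :* u :* t) :* γ) := :0#) refl (u c′) t γ ⟩
        0#                  ≡⟨ identity-pivot-punchIn Q c′ ⟨
        I Q (punchIn Q c′)  ∎

      BA-there-here : ∀ c → expandBA (punchIn Q c) Q ≡ I (punchIn Q c) Q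
      BA-there-here c = begin
        expandBA (punchIn Q c) Q
          ≡⟨ cong₂ _+_ (cong₂ _*_ (B-column c) A-pivot) (sum-cong-≗ λ r → cong₂ _*_ (B-minor c r) (A-column r)) ⟩
        - (t * β c) * p + β c ≡⟨ cong (_+ β c) (*-comm _ p) ⟩
        p * - (t * β c) + β c ≡⟨ cancel-pivot (β c) ⟩
        0#                    ≡⟨ identity-punchIn-pivot Q c ⟨
        I (punchIn Q c) Q     ∎

      BA-there-there : ∀ c c′ → expandBA (punchIn Q c) (punchIn Q c′) ≡ I (punchIn Q c) (punchIn Q c′)
      BA-there-there c c′ = begin
        expandBA (punchIn Q c) (punchIn Q c′)
          ≡⟨ cong₂ _+_ (cong₂ _*_ (B-column c) (A-row c′)) (sum-cong-≗ λ r → cong₂ _*_ (B-minor c r) (A-minor r c′)) ⟩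
        - (t * β c) * u c′ + (sum λ r → entry F T c r * M r c′)
          ≡⟨ cong (- (t * β c) * u c′ +_)
                  (∑-linear _ (λ r → entry F T c r * entry F S r c′) (λ r → entry F T c r * v r) 1# (u c′ * t)
                     (λ r → solve 5 (λ b s w u t → b :* (s :+ w :* u :* t) := :1# :* (b :* s) :+ u :* t :* (b :* w))
                                    refl (entry F T c r) (entry F S r c′) (v r) (u c′) t)) ⟩
        - (t * β c) * u c′ + (1# * (sum λ r → entry F T c r * entry F S r c′) + u c′ * t * β c)
          ≡⟨ cong (λ x → - (t * β c) * u c′ + (1# * x + u c′ * t * β c)) (TS c c′) ⟩
        - (t * β c) * u c′ + (1# * I c c′ + u c′ * t * β c)
          ≡⟨ solve 4 (λ t b u d → :- (t :* b) :* u :+ (:1# :* d :+ u :* t :* b) := d) refl t (β c) (u c′) (I c c′) ⟩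
        I c c′                          ≡⟨ identity-punchIn Q c c′ ⟨
        I (punchIn Q c) (punchIn Q c′)  ∎

    block-inverseʳ : _·_ F A B ≡ identity F
    block-inverseʳ = ≡-fromEntries λ R R′ → trans (entry-·-split A B Q R R′) (expanded R R′)
      where
      expanded : ∀ R R′ → expandAB R R′ ≡ I R R′
      expanded R R′ with punchInView P R | punchInView P R′
      ... | here    | here     = AB-here-here
      ... | here    | there r′ = AB-here-there r′
      ... | there r | here     = AB-there-here r
      ... | there r | there r′ = AB-there-there r r′

    block-inverseˡ : _·_ F B A ≡ identity F
    block-inverseˡ = ≡-fromEntries λ C C′ → trans (entry-·-split B A P C C′) (expanded C C′)
      where
      expanded : ∀ C C′ → expandBA C C′ ≡ I C C′
      expanded C C′ with punchInView Q C | punchInView Q C′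
      ... | here    | here     = BA-here-here
      ... | here    | there c′ = BA-here-there c′
      ... | there c | here     = BA-there-here c
      ... | there c | there c′ = BA-there-there c c′

    invertible : Invertible F A
    invertible = B , block-inverseʳ , block-inverseˡ

  block-invertible : ∀ {p} → p ≢ 0# → (u v : Fin m → Carrier) {S : Mat F m} → Invertible F S →
                     Invertible F (fromFun (block p u v λ r c → entry F S r c + v r * u c * p ⁻¹))
  block-invertible p≢0 u v {S} (T , ST≡I , TS≡I) = BlockInverse.invertible p≢0 u v {S} {T} ST≡I TS≡I

-- Adjacent transpositions and the diagram O_w

swapAdj-involutive : ∀ {n} (j : Fin n) k → swapAdj j (swapAdj j k) ≡ k
swapAdj-involutive zero    zero          = refl
swapAdj-involutive zero    (suc zero)    = refl
swapAdj-involutive zero    (suc (suc k)) = refl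
swapAdj-involutive (suc j) zero          = refl
swapAdj-involutive (suc j) (suc k)       = cong suc (swapAdj-involutive j k)

swapAdj-inject₁ : ∀ {n} (j : Fin n) → swapAdj j (inject₁ j) ≡ suc j
swapAdj-inject₁ zero    = refl
swapAdj-inject₁ (suc j) = cong suc (swapAdj-inject₁ j)

swapAdj-suc : ∀ {n} (j : Fin n) → swapAdj j (suc j) ≡ inject₁ j
swapAdj-suc zero    = refl
swapAdj-suc (suc j) = cong suc (swapAdj-suc j)

swapAdj-mono : ∀ {n} (j : Fin n) {a b} → a Fin.< b → ¬ (a ≡ inject₁ j × b ≡ suc j) → swapAdj j a Fin.< swapAdj j b
swapAdj-mono zero    {zero}        {suc zero}    a<b       ¬swapped = ⊥-elim (¬swapped (refl , refl))
swapAdj-mono zero    {zero}        {suc (suc b)} a<b       ¬swapped = ℕ.s≤s (ℕ.s≤s ℕ.z≤n)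
swapAdj-mono zero    {suc zero}    {suc (suc b)} a<b       ¬swapped = ℕ.s≤s ℕ.z≤n
swapAdj-mono zero    {suc zero}    {suc zero}    (ℕ.s≤s ()) ¬swapped
swapAdj-mono zero    {suc (suc a)} {suc zero}    (ℕ.s≤s ()) ¬swapped
swapAdj-mono zero    {suc (suc a)} {suc (suc b)} a<b       ¬swapped = a<b
swapAdj-mono (suc j) {zero}        {suc b}       a<b       ¬swapped = ℕ.s≤s ℕ.z≤n
swapAdj-mono (suc j) {suc a}       {suc b}       (ℕ.s≤s a<b) ¬swapped =
  ℕ.s≤s (swapAdj-mono j a<b λ { (refl , refl) → ¬swapped (refl , refl) })

punchIn-suc-inject₁ : ∀ {n} (j : Fin n) → punchIn (suc j) j ≡ inject₁ j
punchIn-suc-inject₁ zero    = refl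
punchIn-suc-inject₁ (suc j) = cong suc (punchIn-suc-inject₁ j)

swapAdj-permutation : ∀ {n} → Fin n → Permutation′ (suc n)
swapAdj-permutation j = permutation (swapAdj j) (swapAdj j) (swapAdj-involutive j) (swapAdj-involutive j)

O? : ∀ {n} (v : Fin n → Fin n) → ∀ r c → Dec (O v r c)
O? v r c = Finₚ.any? λ b → (r Fin.<? b) ×-dec (v b Finₚ.≟ c) ×-dec (v r Fin.<? c)

HasCard-punchIn : ∀ {n k} {P : Pred (Fin (suc n)) 0ℓ} (K : Fin (suc n)) →
                  Decidable P → ¬ P K → HasCard P k → HasCard (P ∘ punchIn K) k
HasCard-punchIn {n} {P = P} K P? ¬PK Pk
  with _ , P∘punchIn ← HasCard-decidable (P? ∘ punchIn K) (HasCard-Fin n) =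
  subst (HasCard (P ∘ punchIn K)) (HasCard-unique (image P∘punchIn) Pk) P∘punchIn
  where
  image : ∀ {k′} → HasCard (P ∘ punchIn K) k′ → HasCard P k′
  image P∘punchIn = HasCard-resp-≐ ((λ { (_ , Pc , refl) → Pc }) , preimage)
                                   (HasCard-image (punchIn K) (λ _ _ → Finₚ.punchIn-injective K _ _) P∘punchIn)
    where
    preimage : ∀ {C} → P C → ∃ λ c → P (punchIn K c) × punchIn K c ≡ C
    preimage {C} PC with punchInView K C
    ... | here    = ⊥-elim (¬PK PC)
    ... | there c = c , PC , refl

module HeavyDescent {m : ℕ} (w : Fin (suc m) → Fin (suc m)) (w-injective : Injective _≡_ _≡_ w) (i : Fin m)
  (descent : w (suc i) Fin.< w (inject₁ i))
  (right-larger : ∀ k → suc i Fin.< k → ¬ (w k Fin.< w (suc i)))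
  (left-smaller : ∀ k → k Fin.< inject₁ i → ¬ (w (inject₁ i) Fin.< w k)) where

  -- The pivot (i+1, w_i) of the paper; rows and columns are 0-indexed.
  r₀ x : Fin (suc m)
  r₀ = suc i
  x  = w (inject₁ i)

  σ : Permutation′ (suc m)
  σ = swapAdj-permutation i

  private
    inject₁<r₀ : inject₁ i Fin.< r₀
    inject₁<r₀ = Finₚ.≤̄⇒inject₁< Finₚ.≤-refl

    w-< : ∀ {a b} → a ≢ b → ¬ (w b Fin.< w a) → w a Fin.< w b
    w-< a≢b ¬wb<wa = Finₚ.≤∧≢⇒< (ℕₚ.≮⇒≥ ¬wb<wa) (a≢b ∘ w-injective)

    w-left : ∀ R → R Fin.< inject₁ i → w R Fin.< x
    w-left R R<i = w-< (Finₚ.<⇒≢ R<i) (left-smaller R R<i)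

    w-right : ∀ b → r₀ Fin.< b → w r₀ Fin.< w b
    w-right b r₀<b = w-< (Finₚ.<⇒≢ r₀<b) (right-larger b r₀<b)

  ¬O-pivot : ¬ O w r₀ x
  ¬O-pivot (b , r₀<b , wb≡x , _) rewrite w-injective wb≡x = Finₚ.<-asym r₀<b inject₁<r₀

  O-column : ∀ R → O w R x ⇔ R Fin.< inject₁ i
  O-column R = mk⇔ (λ { (b , R<b , wb≡x , _) → subst (R Fin.<_) (w-injective wb≡x) R<b })
                   (λ R<i → inject₁ i , R<i , refl , w-left R R<i)

  O-row : ∀ C → O w r₀ C ⇔ ∃ λ b → r₀ Fin.< b × w b ≡ C
  O-row C = mk⇔ (λ { (b , r₀<b , wb≡C , _) → b , r₀<b , wb≡C })
                (λ { (b , r₀<b , refl) → b , r₀<b , refl , w-right b r₀<b })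

  -- This is what lets the Schur complement inherit the zero pattern of the minor.
  O-split : ∀ {R C} → O w R C → O w R x ⊎ O w r₀ C
  O-split {R} {C} (b , R<b , wb≡C , wR<C) with R Fin.<? inject₁ i | b Finₚ.≟ r₀
  ... | yes R<i | _        = inj₁ (from (O-column R) R<i)
  ... | no R≮i  | yes refl = ⊥-elim (Finₚ.<-asym descent (subst (λ R → w R Fin.< w r₀) R≡i (subst (w R Fin.<_) (sym wb≡C) wR<C)))
    where
    R≡i : R ≡ inject₁ i
    R≡i = Finₚ.toℕ-injective (ℕₚ.≤-antisym (subst (toℕ R ℕ.≤_) (sym (Finₚ.toℕ-inject₁ i)) (ℕ.s≤s⁻¹ R<b))
                                           (ℕₚ.≮⇒≥ R≮i))
  ... | no R≮i  | no b≢r₀  = inj₂ (from (O-row C) (b , r₀<b , wb≡C))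
    where
    r₀<b : r₀ Fin.< b
    r₀<b = Finₚ.≤∧≢⇒< (ℕₚ.≤-trans (ℕ.s≤s (subst (ℕ._≤ toℕ R) (Finₚ.toℕ-inject₁ i) (ℕₚ.≮⇒≥ R≮i))) R<b)
                       (b≢r₀ ∘ sym)

  O-swap⁺ : ∀ {ρ c} → O w ρ c → O (sAct i w) (σ ⟨$⟩ʳ ρ) c
  O-swap⁺ {ρ} {c} (b , ρ<b , wb≡c , wρ<c) =
    σ ⟨$⟩ʳ b , swapAdj-mono i ρ<b ¬swapped ,
    trans (cong w (swapAdj-involutive i b)) wb≡c , subst (λ k → w k Fin.< c) (sym (swapAdj-involutive i ρ)) wρ<c
    where
    ¬swapped : ¬ (ρ ≡ inject₁ i × b ≡ r₀)
    ¬swapped (refl , refl) = Finₚ.<-asym descent (subst (x Fin.<_) (sym wb≡c) wρ<c)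

  O-swap-pivot : O (sAct i w) (σ ⟨$⟩ʳ r₀) x
  O-swap-pivot =
    r₀ , subst (Fin._< r₀) (sym (swapAdj-suc i)) inject₁<r₀ , cong w (swapAdj-suc i) ,
    subst (λ k → w k Fin.< x) (sym (trans (cong (swapAdj i) (swapAdj-suc i)) (swapAdj-inject₁ i))) descent

  O-swap⁻ : ∀ {ρ c} → O (sAct i w) ρ c → O w (σ ⟨$⟩ʳ ρ) c ⊎ (σ ⟨$⟩ʳ ρ ≡ r₀ × c ≡ x)
  O-swap⁻ {ρ} {c} (b , ρ<b , wσb≡c , wσρ<c) with ρ Finₚ.≟ inject₁ i ×-dec b Finₚ.≟ r₀
  ... | yes (refl , refl) = inj₂ (swapAdj-inject₁ i , trans (sym wσb≡c) (cong w (swapAdj-suc i)))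
  ... | no ¬swapped       = inj₁ (σ ⟨$⟩ʳ b , swapAdj-mono i ρ<b ¬swapped , wσb≡c , wσρ<c)

  ZeroInRow ZeroInColumn : Pred (Fin m) 0ℓ
  ZeroInRow c    = O w r₀ (punchIn x c)
  ZeroInColumn r = O w (punchIn r₀ r) x

  HasCard-∁ZeroInRow : HasCard (∁ ZeroInRow) (suc (toℕ i))
  HasCard-∁ZeroInRow =
    subst (HasCard (∁ ZeroInRow)) (ℕₚ.m∸[m∸n]≡n (Finₚ.toℕ<n i))
      (HasCard-∁ (O? w r₀ ∘ punchIn x) (HasCard-Fin m) (HasCard-punchIn x (O? w r₀) ¬O-pivot row-zeros))
    where
    row-zeros : HasCard (O w r₀) (m ℕ.∸ suc (toℕ i))
    row-zeros = HasCard-resp-≐ (from (O-row _) , to (O-row _))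
                               (HasCard-image w (λ _ _ → w-injective) (HasCard-≤ (suc m) (suc (suc (toℕ i)))))

  HasCard-∁ZeroInColumn : HasCard (∁ ZeroInColumn) (m ℕ.∸ toℕ i)
  HasCard-∁ZeroInColumn = HasCard-resp-≐ (i≤r⇒nonzero , nonzero⇒i≤r) (HasCard-≤ m (toℕ i))
    where
    i≤r⇒nonzero : ∀ {r} → toℕ i ℕ.≤ toℕ r → ¬ ZeroInColumn r
    i≤r⇒nonzero {r} i≤r O-entry = ℕₚ.<⇒≱ (to (O-column (punchIn r₀ r)) O-entry)
                                        (subst (Fin._≤ punchIn r₀ r) (punchIn-suc-inject₁ i) (Finₚ.punchIn-mono-≤ r₀ i r i≤r))

    nonzero⇒i≤r : ∀ {r} → ¬ ZeroInColumn r → toℕ i ℕ.≤ toℕ r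
    nonzero⇒i≤r {r} nonzero = Finₚ.punchIn-cancel-≤ r₀ i r
      (subst (Fin._≤ punchIn r₀ r) (sym (punchIn-suc-inject₁ i)) (ℕₚ.≮⇒≥ (nonzero ∘ from (O-column (punchIn r₀ r)))))

  free-entries : suc (toℕ i) ℕ.+ (m ℕ.∸ toℕ i) ≡ suc m
  free-entries = cong suc (ℕₚ.m+[n∸m]≡n (ℕₚ.<⇒≤ (Finₚ.toℕ<n i)))

-- Counting the matrices with zero and with nonzero pivot

module Counting {q : ℕ} (F : FiniteField q) {m : ℕ} (w : Fin (suc m) → Fin (suc m))
  (w-injective : Injective _≡_ _≡_ w) (i : Fin m)
  (descent : w (suc i) Fin.< w (inject₁ i))
  (right-larger : ∀ k → suc i Fin.< k → ¬ (w k Fin.< w (suc i)))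
  (left-smaller : ∀ k → k Fin.< inject₁ i → ¬ (w (inject₁ i) Fin.< w k)) where

  open FieldProperties F
  open MatrixProperties F
  open HeavyDescent w w-injective i descent right-larger left-smaller
  open Pivoting F r₀ x
  open Block {X = Carrier} r₀ x

  PivotZero : Pred (Mat F (suc m)) 0ℓ
  PivotZero A = entry F A r₀ x ≡ 0#

  PivotZero? : Decidable PivotZero
  PivotZero? A = entry F A r₀ x ≟ 0#

  HasCard-PivotZero : ∀ {b} → HasCard (InM F (suc m) (O (sAct i w))) b → HasCard (InM F (suc m) (O w) ∩ PivotZero) b
  HasCard-PivotZero Hb = HasCard-resp-≐ (swapped⇒ , ⇒swapped) (HasCard-image (permuteRows σ) permuteRows-injective Hb)
    where
    permuteRows-σ-involutive : ∀ A → permuteRows σ (permuteRows σ A) ≡ A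
    permuteRows-σ-involutive = permuteRows-involutive σ (swapAdj-involutive i)

    permuteRows-injective : ∀ {A A′} → InM F (suc m) (O (sAct i w)) A → InM F (suc m) (O (sAct i w)) A′ →
                            permuteRows σ A ≡ permuteRows σ A′ → A ≡ A′
    permuteRows-injective {A} {A′} _ _ σA≡σA′ =
      trans (sym (permuteRows-σ-involutive A)) (trans (cong (permuteRows σ) σA≡σA′) (permuteRows-σ-involutive A′))

    swapped⇒ : ∀ {A} → (∃ λ A′ → InM F (suc m) (O (sAct i w)) A′ × permuteRows σ A′ ≡ A) →
               (InM F (suc m) (O w) ∩ PivotZero) A
    swapped⇒ (A′ , (A′-invertible , A′-zeros) , refl) =
      (permuteRows-invertible σ {A′} A′-invertible ,
       λ ρ c ρc∈O → trans (entry-permuteRows σ A′ ρ c) (A′-zeros _ c (O-swap⁺ ρc∈O))) ,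
      trans (entry-permuteRows σ A′ r₀ x) (A′-zeros _ x O-swap-pivot)

    ⇒swapped : ∀ {A} → (InM F (suc m) (O w) ∩ PivotZero) A →
               ∃ λ A′ → InM F (suc m) (O (sAct i w)) A′ × permuteRows σ A′ ≡ A
    ⇒swapped {A} ((A-invertible , A-zeros) , pivot≡0) =
      permuteRows σ A , (permuteRows-invertible σ {A} A-invertible , zeros) , permuteRows-σ-involutive A
      where
      zeros : ∀ ρ c → O (sAct i w) ρ c → entry F (permuteRows σ A) ρ c ≡ 0#
      zeros ρ c ρc∈O with O-swap⁻ ρc∈O
      ... | inj₁ σρc∈O          = trans (entry-permuteRows σ A ρ c) (A-zeros _ c σρc∈O)
      ... | inj₂ (σρ≡r₀ , c≡x) = trans (entry-permuteRows σ A ρ c) (trans (cong₂ (entry F A) σρ≡r₀ c≡x) pivot≡0)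

  Minor : Pred (Mat F m) 0ℓ
  Minor = InM F m (O w minus (r₀ , x))

  -- ((pivot row, pivot column), (pivot, Schur complement)) of a matrix with nonzero pivot
  Parameters : Set
  Parameters = (Vec Carrier m × Vec Carrier m) × (Carrier × Mat F m)

  Admissible : Pred Parameters 0ℓ
  Admissible = (VanishOn ZeroInRow ⟨×⟩ VanishOn ZeroInColumn) ⟨×⟩ (∁ (_≡ 0#) ⟨×⟩ Minor)

  assembleEntries : Parameters → Fin (suc m) → Fin (suc m) → Carrier
  assembleEntries ((u , v) , (p , S)) = block p (lookup u) (lookup v) λ r c → entry F S r c + lookup v r * lookup u c * p ⁻¹

  assemble : Parameters → Mat F (suc m)
  assemble = fromFun ∘ assembleEntries

  disassemble : Mat F (suc m) → Parameters
  disassemble A = (tabulate (pivotRow A) , tabulate (pivotColumn A)) , (pivot A , fromFun (schur A))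

  disassemble∘assemble : ∀ t → disassemble (assemble t) ≡ t
  disassemble∘assemble t@((u , v) , (p , S)) =
    cong₂ _,_ (cong₂ _,_ (tabulate-lookup (pivotRow-block _ _ _ _)) (tabulate-lookup (pivotColumn-block _ _ _ _)))
              (cong₂ _,_ (pivot-block _ _ _ _) (≡-fromEntries schur≡S))
    where
    A : Mat F (suc m)
    A = assemble t

    tabulate-lookup : ∀ {f} {xs : Vec Carrier m} → (∀ k → f k ≡ lookup xs k) → tabulate f ≡ xs
    tabulate-lookup {xs = xs} f≗xs = trans (tabulate-cong f≗xs) (tabulate∘lookup xs)

    schur≡S : ∀ r c → entry F (fromFun (schur A)) r c ≡ entry F S r c
    schur≡S r c = begin
      entry F (fromFun (schur A)) r c ≡⟨ entry-fromFun (schur A) r c ⟩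
      minor A r c - pivotColumn A r * pivotRow A c * pivot A ⁻¹
        ≡⟨ cong₂ _-_ (minor-block _ _ _ _ r c)
                     (cong₂ _*_ (cong₂ _*_ (pivotColumn-block _ _ _ _ r) (pivotRow-block _ _ _ _ c))
                                (cong _⁻¹ (pivot-block _ _ _ _))) ⟩
      entry F S r c + lookup v r * lookup u c * p ⁻¹ - lookup v r * lookup u c * p ⁻¹
        ≡⟨ solve 2 (λ s y → s :+ y :- y := s) refl (entry F S r c) (lookup v r * lookup u c * p ⁻¹) ⟩
      entry F S r c ∎

  assemble∘disassemble : ∀ A → assemble (disassemble A) ≡ A
  assemble∘disassemble A = ≡-fromEntries λ R C → begin
    entry F (assemble (disassemble A)) R C
      ≡⟨ entry-fromFun (assembleEntries (disassemble A)) R C ⟩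
    block (pivot A) (lookup (tabulate (pivotRow A))) (lookup (tabulate (pivotColumn A))) _ R C
      ≡⟨ block-cong refl (lookup∘tabulate (pivotRow A)) (lookup∘tabulate (pivotColumn A)) minor≗ R C ⟩
    block (pivot A) (pivotRow A) (pivotColumn A) (minor A) R C
      ≡⟨ entry≡block A R C ⟨
    entry F A R C ∎
    where
    minor≗ : ∀ r c → entry F (fromFun (schur A)) r c +
                     lookup (tabulate (pivotColumn A)) r * lookup (tabulate (pivotRow A)) c * pivot A ⁻¹ ≡ minor A r c
    minor≗ r c = begin
      _ ≡⟨ cong₂ (λ s y → s + y * pivot A ⁻¹) (entry-fromFun (schur A) r c)
                 (cong₂ _*_ (lookup∘tabulate (pivotColumn A) r) (lookup∘tabulate (pivotRow A) c)) ⟩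
      minor A r c - pivotColumn A r * pivotRow A c * pivot A ⁻¹ + pivotColumn A r * pivotRow A c * pivot A ⁻¹
        ≡⟨ solve 2 (λ s y → s :- y :+ y := s) refl (minor A r c) (pivotColumn A r * pivotRow A c * pivot A ⁻¹) ⟩
      minor A r c ∎

  private
    update-vanishes : ∀ {a b} t → a ≡ 0# ⊎ b ≡ 0# → a * b * t ≡ 0#
    update-vanishes {b = b} t (inj₁ refl) = trans (cong (_* t) (zeroˡ b)) (zeroˡ t)
    update-vanishes {a = a} t (inj₂ refl) = trans (cong (_* t) (zeroʳ a)) (zeroˡ t)

  assemble-admissible : ∀ {t} → Admissible t → (InM F (suc m) (O w) ∩ ∁ PivotZero) (assemble t)
  assemble-admissible {t@((u , v) , (p , S))} ((u-zeros , v-zeros) , (p≢0 , S-invertible , S-zeros)) =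
    (block-invertible p≢0 (lookup u) (lookup v) {S} S-invertible , zeros) , p≢0 ∘ trans (sym (pivot-block _ _ _ _))
    where
    zeros : ∀ R C → O w R C → entry F (assemble t) R C ≡ 0#
    zeros R C RC∈O with punchInView r₀ R | punchInView x C
    ... | here    | here    = ⊥-elim (¬O-pivot RC∈O)
    ... | here    | there c = trans (pivotRow-block _ _ _ _ c) (u-zeros c RC∈O)
    ... | there r | here    = trans (pivotColumn-block _ _ _ _ r) (v-zeros r RC∈O)
    ... | there r | there c = begin
      minor (assemble t) r c                               ≡⟨ minor-block _ _ _ _ r c ⟩
      entry F S r c + lookup v r * lookup u c * p ⁻¹       ≡⟨ cong₂ _+_ (S-zeros r c RC∈O) (update-vanishes (p ⁻¹) v∨u≡0) ⟩
      0# + 0#                                              ≡⟨ +-identityʳ 0# ⟩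
      0#                                                   ∎
      where
      v∨u≡0 : lookup v r ≡ 0# ⊎ lookup u c ≡ 0#
      v∨u≡0 = Sum.map (v-zeros r) (u-zeros c) (O-split RC∈O)

  disassemble-admissible : ∀ {A} → (InM F (suc m) (O w) ∩ ∁ PivotZero) A → Admissible (disassemble A)
  disassemble-admissible {A} ((A-invertible , A-zeros) , p≢0) =
    ((λ c z → trans (lookup∘tabulate (pivotRow A) c) (A-zeros _ _ z)) ,
     (λ r z → trans (lookup∘tabulate (pivotColumn A) r) (A-zeros _ _ z))) ,
    (p≢0 , schur-invertible {A} p≢0 A-invertible , schur-zeros)
    where
    schur-zeros : ∀ r c → (O w minus (r₀ , x)) r c → entry F (fromFun (schur A)) r c ≡ 0#
    schur-zeros r c rc∈O = begin
      entry F (fromFun (schur A)) r c                              ≡⟨ entry-fromFun (schur A) r c ⟩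
      minor A r c - pivotColumn A r * pivotRow A c * pivot A ⁻¹
        ≡⟨ cong₂ _-_ (A-zeros _ _ rc∈O) (update-vanishes (pivot A ⁻¹) v∨u≡0) ⟩
      0# - 0#                                                      ≡⟨ -‿inverseʳ 0# ⟩
      0#                                                           ∎
      where
      v∨u≡0 : pivotColumn A r ≡ 0# ⊎ pivotRow A c ≡ 0#
      v∨u≡0 = Sum.map (A-zeros _ _) (A-zeros _ _) (O-split rc∈O)

  HasCard-Admissible : ∀ {c} → HasCard Minor c →
                       HasCard Admissible (q ^ suc (toℕ i) ℕ.* q ^ (m ℕ.∸ toℕ i) ℕ.* ((q ℕ.∸ 1) ℕ.* c))
  HasCard-Admissible Hc =
    HasCard-× (HasCard-× (HasCard-VanishOn (O? w r₀ ∘ punchIn x) HasCard-∁ZeroInRow)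
                         (HasCard-VanishOn (λ r → O? w (punchIn r₀ r) x) HasCard-∁ZeroInColumn))
              (HasCard-× HasCard-nonzero Hc)

  HasCard-PivotNonzero : ∀ {c} → HasCard Minor c →
                         HasCard (InM F (suc m) (O w) ∩ ∁ PivotZero) (q ^ suc m ℕ.* (q ℕ.∸ 1) ℕ.* c)
  HasCard-PivotNonzero {c} Hc =
    subst (HasCard _) count
      (HasCard-resp-≐ ((λ { (t , t-admissible , refl) → assemble-admissible {t} t-admissible }) ,
                       (λ {A} A∈ → disassemble A , disassemble-admissible {A} A∈ , assemble∘disassemble A))
                      (HasCard-image assemble assemble-injective (HasCard-Admissible Hc)))
    where
    assemble-injective : ∀ {t t′} → Admissible t → Admissible t′ → assemble t ≡ assemble t′ → t ≡ t′
    assemble-injective {t} {t′} _ _ assembled≡ =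
      trans (sym (disassemble∘assemble t)) (trans (cong disassemble assembled≡) (disassemble∘assemble t′))

    count : q ^ suc (toℕ i) ℕ.* q ^ (m ℕ.∸ toℕ i) ℕ.* ((q ℕ.∸ 1) ℕ.* c) ≡ q ^ suc m ℕ.* (q ℕ.∸ 1) ℕ.* c
    count = begin
      q ^ suc (toℕ i) ℕ.* q ^ (m ℕ.∸ toℕ i) ℕ.* ((q ℕ.∸ 1) ℕ.* c)
        ≡⟨ cong (ℕ._* ((q ℕ.∸ 1) ℕ.* c)) (ℕₚ.^-distribˡ-+-* q (suc (toℕ i)) (m ℕ.∸ toℕ i)) ⟨
      q ^ (suc (toℕ i) ℕ.+ (m ℕ.∸ toℕ i)) ℕ.* ((q ℕ.∸ 1) ℕ.* c)
        ≡⟨ cong (λ e → q ^ e ℕ.* ((q ℕ.∸ 1) ℕ.* c)) free-entries ⟩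
      q ^ suc m ℕ.* ((q ℕ.∸ 1) ℕ.* c)
        ≡⟨ ℕₚ.*-assoc (q ^ suc m) (q ℕ.∸ 1) c ⟨
      q ^ suc m ℕ.* (q ℕ.∸ 1) ℕ.* c ∎

open import Data.Nat using (_+_; _*_; _∸_)

proposition3p8 : (m : ℕ) (w : Fin (suc m) → Fin (suc m)) → Injective _≡_ _≡_ w →
    (i : Fin m) → FirstDescentAt w i → HeavyReductionPair w i →
    (q : ℕ) (F : FiniteField q) (a b c : ℕ) →
    HasCard (InM F (suc m) (O w)) a →
    HasCard (InM F (suc m) (O (sAct i w))) b →
    HasCard (InM F m (O w minus (suc i , w (inject₁ i)))) c →
    a ≡ b + q ^ suc m * (q ∸ 1) * c
proposition3p8 m w w-injective i _ (descent , right-larger , left-smaller , _) q F a b c Ha Hb Hc =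
  HasCard-unique Ha (HasCard-split PivotZero? (HasCard-PivotZero Hb) (HasCard-PivotNonzero Hc))
  where open Counting F w w-injective i descent right-larger left-smaller
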